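{- If $n$ is a non-negative integer, then \[ \sum_{k = 1}^n \sum_{j = 0}^{k - 1} \frac{H_{n-j}}{k-j} = (n+1)H_n^2 - (2n+1)H_n + 2n, \] \[ \sum_{k = 1}^n \sum_{j = 0}^{k - 1} \frac{H_{n-j}^2}{k-j} = (n+1)H_n^3 - \frac{3}{2}(2n+1)H_n^2 + 3(2n+1)H_n + \frac{1}{2}H_n^{(2)} - 6n, \] and \[ \sum_{k = 1}^n \sum_{j = 0}^{k - 1} \frac{H_{n-j}^{(2)}}{k-j} = (n+1)H_n H_n^{(2)} - \frac{1}{2}(2n+1)H_n^{(2)} + H_n - \frac{1}{2}H_n^2. \]
   Context: $H_n=\sum_{m=1}^n\frac1m$ and $H_n^{(2)}=\sum_{m=1}^n\frac1{m^2}$. Empty sums are $0$. -}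

module Defs where

open import Data.Nat using (ℕ; zero; suc; _∸_)
open import Data.Integer using (+_)
open import Data.Rational using (ℚ; 0ℚ; _+_; _*_; _/_)

inv-suc : ℕ → ℚ
inv-suc m = + 1 / suc m

H : ℕ → ℚ
H zero    = 0ℚ
H (suc n) = H n + inv-suc n

H2 : ℕ → ℚ
H2 zero    = 0ℚ
H2 (suc n) = H2 n + (+ 1 / (suc n Data.Nat.* suc n))

sumBelow : ℕ → (ℕ → ℚ) → ℚ
sumBelow zero    f = 0ℚ
sumBelow (suc b) f = sumBelow b f + f b

-- Σ_{k=1}^n Σ_{j=0}^{k-1} a(n-j) / (k-j)
-- k ranges over 1..n written as k = k' + 1 with k' < n; then k - j = suc (k' ∸ j) for j ≤ k'.
doubleSum : ℕ → (ℕ → ℚ) → ℚ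
doubleSum n a =
  sumBelow n (λ k' → sumBelow (suc k') (λ j → a (n ∸ j) * inv-suc (k' ∸ j)))

-- Summing over k first gives Σ_{k=j+1}^{n} 1/(k-j) = H_{n-j}, so the double sum is
-- Σ_{m=1}^n a_m H_m (a = H, H², H^(2)). Each right-hand side is a polynomial F(n, H_n, H_n^(2))
-- vanishing at n = 0, and with x = 1/(n+1) the defect
-- F(n+1, H_n + x, H_n^(2) + x²) - F(n, H_n, H_n^(2)) - a_{n+1} H_{n+1}
-- is a polynomial multiple of (n+1)x - 1, so the closed forms follow by induction on n.
module Submission where

open import Defs
open import Algebra.Bundles using (CommutativeMonoid)
open import Data.Nat using (ℕ; zero; suc; _∸_; _<_; s≤s)
import Data.Nat as ℕ
import Data.Nat.Properties as ℕ
open import Data.Integer as ℤ using (+_)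
import Data.Integer.Properties as ℤ
open import Data.Product using (_×_; _,_)
open import Data.Rational using (ℚ; 0ℚ; 1ℚ; _+_; _*_; _-_; _/_; ½; fromℚᵘ)
open import Data.Rational.Properties
  using ( _≟_; +-assoc; +-comm; +-identityˡ; +-identityʳ; *-zeroˡ; *-zeroʳ; *-distribˡ-+
        ; +-0-commutativeMonoid; +-*-commutativeRing
        ; toℚᵘ-injective; toℚᵘ-fromℚᵘ; fromℚᵘ-cong; toℚᵘ-homo-+; toℚᵘ-homo-* )
open import Data.Rational.Unnormalised as ℚᵘ using (mkℚᵘ; *≡*)
import Data.Rational.Unnormalised.Properties as ℚᵘₚ
open import Level using (0ℓ)
open import Relation.Binary.PropositionalEquality
open import Relation.Nullary.Decidable using (dec⇒maybe)
open import Tactic.RingSolver using (solve-∀)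
open import Tactic.RingSolver.Core.AlmostCommutativeRing using (AlmostCommutativeRing; fromCommutativeRing)
open import Algebra.Properties.CommutativeSemigroup
  (CommutativeMonoid.commutativeSemigroup +-0-commutativeMonoid) using (interchange)

ℚ-ring : AlmostCommutativeRing 0ℓ 0ℓ
ℚ-ring = fromCommutativeRing +-*-commutativeRing (λ q → dec⇒maybe (0ℚ ≟ q))

fromℚᵘ-homo-+ : ∀ p q → fromℚᵘ (p ℚᵘ.+ q) ≡ fromℚᵘ p + fromℚᵘ q
fromℚᵘ-homo-+ p q = toℚᵘ-injective (ℚᵘₚ.≃-trans (toℚᵘ-fromℚᵘ (p ℚᵘ.+ q)) (ℚᵘₚ.≃-sym
  (ℚᵘₚ.≃-trans (toℚᵘ-homo-+ (fromℚᵘ p) (fromℚᵘ q)) (ℚᵘₚ.+-cong (toℚᵘ-fromℚᵘ p) (toℚᵘ-fromℚᵘ q)))))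

fromℚᵘ-homo-* : ∀ p q → fromℚᵘ (p ℚᵘ.* q) ≡ fromℚᵘ p * fromℚᵘ q
fromℚᵘ-homo-* p q = toℚᵘ-injective (ℚᵘₚ.≃-trans (toℚᵘ-fromℚᵘ (p ℚᵘ.* q)) (ℚᵘₚ.≃-sym
  (ℚᵘₚ.≃-trans (toℚᵘ-homo-* (fromℚᵘ p) (fromℚᵘ q)) (ℚᵘₚ.*-cong (toℚᵘ-fromℚᵘ p) (toℚᵘ-fromℚᵘ q)))))

fromℕ : ℕ → ℚ
fromℕ k = + k / 1

fromℕ-+ : ∀ k l → fromℕ (k ℕ.+ l) ≡ fromℕ k + fromℕ l
fromℕ-+ k l = trans
  (fromℚᵘ-cong {mkℚᵘ (+ (k ℕ.+ l)) 0} {mkℚᵘ (+ k) 0 ℚᵘ.+ mkℚᵘ (+ l) 0} (*≡* numerators))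
  (fromℚᵘ-homo-+ (mkℚᵘ (+ k) 0) (mkℚᵘ (+ l) 0))
  where
  numerators : + (k ℕ.+ l) ℤ.* + 1 ≡ (+ k ℤ.* + 1 ℤ.+ + l ℤ.* + 1) ℤ.* + 1
  numerators = cong (ℤ._* + 1) (trans (ℤ.pos-+ k l)
    (sym (cong₂ ℤ._+_ (ℤ.*-identityʳ (+ k)) (ℤ.*-identityʳ (+ l)))))

fromℕ-* : ∀ k l → fromℕ (k ℕ.* l) ≡ fromℕ k * fromℕ l
fromℕ-* k l = trans
  (fromℚᵘ-cong {mkℚᵘ (+ (k ℕ.* l)) 0} {mkℚᵘ (+ k) 0 ℚᵘ.* mkℚᵘ (+ l) 0} (*≡* numerators))
  (fromℚᵘ-homo-* (mkℚᵘ (+ k) 0) (mkℚᵘ (+ l) 0))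
  where
  numerators : + (k ℕ.* l) ℤ.* + 1 ≡ (+ k ℤ.* + l) ℤ.* + 1
  numerators = cong (ℤ._* + 1) (ℤ.pos-* k l)

fromℕ-suc : ∀ k → fromℕ (suc k) ≡ fromℕ k + 1ℚ
fromℕ-suc k = trans (fromℕ-+ 1 k) (+-comm 1ℚ (fromℕ k))

fromℕ-suc*inv-suc : ∀ k → fromℕ (suc k) * inv-suc k ≡ 1ℚ
fromℕ-suc*inv-suc k = trans
  (sym (fromℚᵘ-homo-* (mkℚᵘ (+ suc k) 0) (mkℚᵘ (+ 1) k)))
  (fromℚᵘ-cong (ℚᵘₚ.*-inverseʳ (mkℚᵘ (+ suc k) 0)))

H2-suc : ∀ n → H2 (suc n) ≡ H2 n + inv-suc n * inv-suc n
H2-suc n = cong (λ t → H2 n + t) (fromℚᵘ-homo-* (mkℚᵘ (+ 1) n) (mkℚᵘ (+ 1) n))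

sumBelow-cong : ∀ b {f g : ℕ → ℚ} → (∀ i → i < b → f i ≡ g i) → sumBelow b f ≡ sumBelow b g
sumBelow-cong zero    f≗g = refl
sumBelow-cong (suc b) f≗g =
  cong₂ _+_ (sumBelow-cong b (λ i i<b → f≗g i (ℕ.m<n⇒m<1+n i<b))) (f≗g b ℕ.≤-refl)

sumBelow-+ : ∀ b (f g : ℕ → ℚ) → sumBelow b (λ i → f i + g i) ≡ sumBelow b f + sumBelow b g
sumBelow-+ zero    f g = sym (+-identityˡ 0ℚ)
sumBelow-+ (suc b) f g = trans (cong (_+ (f b + g b)) (sumBelow-+ b f g))
  (interchange (sumBelow b f) (sumBelow b g) (f b) (g b))

sumBelow-head : ∀ b (f : ℕ → ℚ) → sumBelow (suc b) f ≡ f 0 + sumBelow b (λ i → f (suc i))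
sumBelow-head zero    f = trans (+-identityˡ (f 0)) (sym (+-identityʳ (f 0)))
sumBelow-head (suc b) f = trans (cong (_+ f (suc b)) (sumBelow-head b f)) (+-assoc (f 0) _ _)

sumBelow-reverse : ∀ n (f : ℕ → ℚ) → sumBelow n (λ j → f (n ∸ j)) ≡ sumBelow n (λ i → f (suc i))
sumBelow-reverse zero    f = refl
sumBelow-reverse (suc n) f = begin
  sumBelow (suc n) (λ j → f (suc n ∸ j))     ≡⟨ sumBelow-head n (λ j → f (suc n ∸ j)) ⟩
  f (suc n) + sumBelow n (λ j → f (n ∸ j))   ≡⟨ cong (λ t → f (suc n) + t) (sumBelow-reverse n f) ⟩
  f (suc n) + sumBelow n (λ i → f (suc i))   ≡⟨ +-comm (f (suc n)) _ ⟩
  sumBelow (suc n) (λ i → f (suc i))         ∎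
  where open ≡-Reasoning

sumBelow-convolution : ∀ n (f g : ℕ → ℚ) →
  sumBelow n (λ k → sumBelow (suc k) (λ j → f j * g (k ∸ j)))
    ≡ sumBelow n (λ j → f j * sumBelow (n ∸ j) g)
sumBelow-convolution zero    f g = refl
sumBelow-convolution (suc n) f g = begin
  sumBelow n (λ k → sumBelow (suc k) (λ j → f j * g (k ∸ j))) + C
    ≡⟨ cong (_+ C) (sumBelow-convolution n f g) ⟩
  R + C
    ≡⟨ cong (_+ C) (sym (+-identityʳ R)) ⟩
  (R + 0ℚ) + C
    ≡⟨ cong (λ t → (R + t) + C) (sym last-term-vanishes) ⟩
  sumBelow (suc n) (λ j → f j * G (n ∸ j)) + C
    ≡⟨ sumBelow-+ (suc n) (λ j → f j * G (n ∸ j)) (λ j → f j * g (n ∸ j)) ⟨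
  sumBelow (suc n) (λ j → f j * G (n ∸ j) + f j * g (n ∸ j))
    ≡⟨ sumBelow-cong (suc n) G-step ⟨
  sumBelow (suc n) (λ j → f j * G (suc n ∸ j))
    ∎
  where
  open ≡-Reasoning
  G : ℕ → ℚ
  G m = sumBelow m g
  R : ℚ
  R = sumBelow n (λ j → f j * G (n ∸ j))
  C : ℚ
  C = sumBelow (suc n) (λ j → f j * g (n ∸ j))
  last-term-vanishes : f n * G (n ∸ n) ≡ 0ℚ
  last-term-vanishes = trans (cong (λ m → f n * G m) (ℕ.n∸n≡0 n)) (*-zeroʳ (f n))
  G-step : ∀ j → j < suc n → f j * G (suc n ∸ j) ≡ f j * G (n ∸ j) + f j * g (n ∸ j)
  G-step j (s≤s j≤n) =
    trans (cong (λ m → f j * G m) (ℕ.+-∸-assoc 1 j≤n)) (*-distribˡ-+ (f j) (G (n ∸ j)) (g (n ∸ j)))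

sumBelow-telescope : ∀ (F g : ℕ → ℚ) → F 0 ≡ 0ℚ → (∀ i → F (suc i) ≡ F i + g i) →
                     ∀ n → sumBelow n g ≡ F n
sumBelow-telescope F g F0≡0 step zero    = sym F0≡0
sumBelow-telescope F g F0≡0 step (suc n) =
  trans (cong (_+ g n) (sumBelow-telescope F g F0≡0 step n)) (sym (step n))

H≡sumBelow-inv-suc : ∀ m → H m ≡ sumBelow m inv-suc
H≡sumBelow-inv-suc zero    = refl
H≡sumBelow-inv-suc (suc m) = cong (_+ inv-suc m) (H≡sumBelow-inv-suc m)

doubleSum≡sumBelow-*H : ∀ n (a : ℕ → ℚ) → doubleSum n a ≡ sumBelow n (λ i → a (suc i) * H (suc i))
doubleSum≡sumBelow-*H n a = begin
  doubleSum n a                                             ≡⟨ sumBelow-convolution n (λ j → a (n ∸ j)) inv-suc ⟩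
  sumBelow n (λ j → a (n ∸ j) * sumBelow (n ∸ j) inv-suc)   ≡⟨ sumBelow-cong n harmonic ⟨
  sumBelow n (λ j → a (n ∸ j) * H (n ∸ j))                  ≡⟨ sumBelow-reverse n (λ m → a m * H m) ⟩
  sumBelow n (λ i → a (suc i) * H (suc i))                  ∎
  where
  open ≡-Reasoning
  harmonic : ∀ j → j < n → a (n ∸ j) * H (n ∸ j) ≡ a (n ∸ j) * sumBelow (n ∸ j) inv-suc
  harmonic j _ = cong (a (n ∸ j) *_) (H≡sumBelow-inv-suc (n ∸ j))

doubleSum-closedForm : (A : ℚ → ℚ → ℚ) (F : ℚ → ℚ → ℚ → ℚ) → F 0ℚ 0ℚ 0ℚ ≡ 0ℚ →
  (∀ ν h h2 x → (ν + 1ℚ) * x ≡ 1ℚ →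
     F (ν + 1ℚ) (h + x) (h2 + x * x) ≡ F ν h h2 + A (h + x) (h2 + x * x) * (h + x)) →
  ∀ n → doubleSum n (λ m → A (H m) (H2 m)) ≡ F (fromℕ n) (H n) (H2 n)
doubleSum-closedForm A F F0≡0 F-step n =
  trans (doubleSum≡sumBelow-*H n a) (sumBelow-telescope Φ (λ i → a (suc i) * H (suc i)) F0≡0 Φ-step n)
  where
  open ≡-Reasoning
  a : ℕ → ℚ
  a m = A (H m) (H2 m)
  Φ : ℕ → ℚ
  Φ m = F (fromℕ m) (H m) (H2 m)
  Φ-step : ∀ m → Φ (suc m) ≡ Φ m + a (suc m) * H (suc m)
  Φ-step m = begin
    F (fromℕ (suc m)) (H (suc m)) (H2 (suc m))
      ≡⟨ cong₂ (λ ν h2 → F ν (H (suc m)) h2) (fromℕ-suc m) (H2-suc m) ⟩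
    F (fromℕ m + 1ℚ) (H m + x) (H2 m + x * x)
      ≡⟨ F-step (fromℕ m) (H m) (H2 m) x νx≡1 ⟩
    Φ m + A (H m + x) (H2 m + x * x) * (H m + x)
      ≡⟨ cong (λ h2 → Φ m + A (H (suc m)) h2 * H (suc m)) (H2-suc m) ⟨
    Φ m + a (suc m) * H (suc m)
      ∎
    where
    x = inv-suc m
    νx≡1 : (fromℕ m + 1ℚ) * x ≡ 1ℚ
    νx≡1 = trans (cong (_* x) (sym (fromℕ-suc m))) (fromℕ-suc*inv-suc m)

-- Each defect below is affine in m = ν + 1 and vanishes when m x = 1, hence equals
-- (m x - 1) q where -q is its value at m = 0; the ring solver checks that factorisation.
≡-modulo-inverse : ∀ {a b c q} → c ≡ 1ℚ → a ≡ b + (c - 1ℚ) * q → a ≡ b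
≡-modulo-inverse {a} {b} {c} {q} c≡1 a≡b+[c-1]q = begin
  a                  ≡⟨ a≡b+[c-1]q ⟩
  b + (c - 1ℚ) * q   ≡⟨ cong (λ t → b + (t - 1ℚ) * q) c≡1 ⟩
  b + 0ℚ * q         ≡⟨ cong (λ t → b + t) (*-zeroˡ q) ⟩
  b + 0ℚ             ≡⟨ +-identityʳ b ⟩
  b                  ∎
  where open ≡-Reasoning

closedForm₁ : ℚ → ℚ → ℚ → ℚ
closedForm₁ ν h _ = (ν + 1ℚ) * h * h - (fromℕ 2 * ν + 1ℚ) * h + fromℕ 2 * ν

closedForm₁-step : ∀ ν h h2 x → (ν + 1ℚ) * x ≡ 1ℚ →
  closedForm₁ (ν + 1ℚ) (h + x) (h2 + x * x) ≡ closedForm₁ ν h h2 + (h + x) * (h + x)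
closedForm₁-step ν h _ x νx≡1 = ≡-modulo-inverse νx≡1 (identity ν h x)
  where
  identity : ∀ ν h x →
    (ν + 1ℚ + 1ℚ) * (h + x) * (h + x) - (fromℕ 2 * (ν + 1ℚ) + 1ℚ) * (h + x) + fromℕ 2 * (ν + 1ℚ)
      ≡ ((ν + 1ℚ) * h * h - (fromℕ 2 * ν + 1ℚ) * h + fromℕ 2 * ν) + (h + x) * (h + x)
        + ((ν + 1ℚ) * x - 1ℚ) * (fromℕ 2 * h + x - fromℕ 2)
  identity = solve-∀ ℚ-ring

closedForm₂ : ℚ → ℚ → ℚ → ℚ
closedForm₂ ν h h2 =
  (ν + 1ℚ) * h * h * h - (+ 3 / 2) * (fromℕ 2 * ν + 1ℚ) * h * h
  + (+ 3 / 1) * (fromℕ 2 * ν + 1ℚ) * h + ½ * h2 - fromℕ 6 * ν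

closedForm₂-step : ∀ ν h h2 x → (ν + 1ℚ) * x ≡ 1ℚ →
  closedForm₂ (ν + 1ℚ) (h + x) (h2 + x * x) ≡ closedForm₂ ν h h2 + (h + x) * (h + x) * (h + x)
closedForm₂-step ν h h2 x νx≡1 = ≡-modulo-inverse νx≡1 (identity ν h h2 x)
  where
  identity : ∀ ν h h2 x →
    (ν + 1ℚ + 1ℚ) * (h + x) * (h + x) * (h + x)
      - (+ 3 / 2) * (fromℕ 2 * (ν + 1ℚ) + 1ℚ) * (h + x) * (h + x)
      + (+ 3 / 1) * (fromℕ 2 * (ν + 1ℚ) + 1ℚ) * (h + x)
      + ½ * (h2 + x * x) - fromℕ 6 * (ν + 1ℚ)
      ≡ ((ν + 1ℚ) * h * h * h - (+ 3 / 2) * (fromℕ 2 * ν + 1ℚ) * h * h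
          + (+ 3 / 1) * (fromℕ 2 * ν + 1ℚ) * h + ½ * h2 - fromℕ 6 * ν)
        + (h + x) * (h + x) * (h + x)
        + ((ν + 1ℚ) * x - 1ℚ)
          * (fromℕ 3 * h * h + fromℕ 3 * h * x + x * x - fromℕ 6 * h - fromℕ 3 * x + fromℕ 6)
  identity = solve-∀ ℚ-ring

closedForm₃ : ℚ → ℚ → ℚ → ℚ
closedForm₃ ν h h2 = (ν + 1ℚ) * h * h2 - ½ * (fromℕ 2 * ν + 1ℚ) * h2 + h - ½ * h * h

closedForm₃-step : ∀ ν h h2 x → (ν + 1ℚ) * x ≡ 1ℚ →
  closedForm₃ (ν + 1ℚ) (h + x) (h2 + x * x) ≡ closedForm₃ ν h h2 + (h2 + x * x) * (h + x)
closedForm₃-step ν h h2 x νx≡1 = ≡-modulo-inverse νx≡1 (identity ν h h2 x)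
  where
  identity : ∀ ν h h2 x →
    (ν + 1ℚ + 1ℚ) * (h + x) * (h2 + x * x) - ½ * (fromℕ 2 * (ν + 1ℚ) + 1ℚ) * (h2 + x * x)
      + (h + x) - ½ * (h + x) * (h + x)
      ≡ ((ν + 1ℚ) * h * h2 - ½ * (fromℕ 2 * ν + 1ℚ) * h2 + h - ½ * h * h)
        + (h2 + x * x) * (h + x)
        + ((ν + 1ℚ) * x - 1ℚ) * (h2 + h * x + x * x - x)
  identity = solve-∀ ℚ-ring

proposition12 : (n : ℕ) →
    (doubleSum n H
       ≡ (+ (n Data.Nat.+ 1) / 1) * H n * H n
         - (+ (2 Data.Nat.* n Data.Nat.+ 1) / 1) * H n
         + (+ (2 Data.Nat.* n) / 1))
    × (doubleSum n (λ m → H m * H m)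
       ≡ (+ (n Data.Nat.+ 1) / 1) * H n * H n * H n
         - (+ 3 / 2) * (+ (2 Data.Nat.* n Data.Nat.+ 1) / 1) * H n * H n
         + (+ 3 / 1) * (+ (2 Data.Nat.* n Data.Nat.+ 1) / 1) * H n
         + ½ * H2 n
         - (+ (6 Data.Nat.* n) / 1))
    × (doubleSum n H2
       ≡ (+ (n Data.Nat.+ 1) / 1) * H n * H2 n
         - ½ * (+ (2 Data.Nat.* n Data.Nat.+ 1) / 1) * H2 n
         + H n
         - ½ * H n * H n)
proposition12 n rewrite fromℕ-+ n 1 | fromℕ-+ (2 ℕ.* n) 1 | fromℕ-* 2 n | fromℕ-* 6 n =
    doubleSum-closedForm (λ h _ → h) closedForm₁ refl closedForm₁-step n
  , doubleSum-closedForm (λ h _ → h * h) closedForm₂ refl closedForm₂-step n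
  , doubleSum-closedForm (λ _ h2 → h2) closedForm₃ refl closedForm₃-step n
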